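{- Let $Q$ be a key with vertices $\{k,k'\}$ and let $v\neq k,k'$ be any other vertex. Then in any acyclic ordering of $Q$, $k\prec v$ if and only if $k'\prec v$. If $q_{kk'}=0$, then $Q$ has either one source and one sink, two sources and one sink, or one source and two sinks; in the case of two sources, both $k$ and $k'$ are sources, and in the case of two sinks, both $k$ and $k'$ are sinks. If $|q_{kk'}|=1$, then $Q$ has exactly one source and one sink.
   Context: A quiver is a finite directed multigraph with no loops and no 2-cycles; $q_{ij}$ is the number of arrows $i\to j$ if positive and minus the number of arrows $j\to i$ otherwise. $Q\setminus V$ denotes the full subquiver on the vertices not in $V$. Abundant: at least two arrows between every pair of distinct vertices; acyclic: no directed cycle. A source (sink) is a vertex with only outgoing (only incoming) arrows. An acyclic ordering is a total order $\prec$ of the vertices such that every arrow $a\to b$ has $a\prec b$. A key with vertices $\{k,k'\}$ ($k\ne k'$) is a quiver $Q$ such that $Q\setminus\{k\}$ and $Q\setminus\{k'\}$ are abundant acyclic, and for every vertex $i\notin\{k,k'\}$ either ($k\to i$ and $k'\to i$) or ($i\to k$ and $i\to k'$); any number of arrows (including zero) is allowed between $k$ and $k'$. -}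

module Defs where

open import Data.Nat using (ℕ; _≤_)
open import Data.Integer using (ℤ; +_; -_; _<_; ∣_∣)
open import Data.Fin using (Fin)
import Data.Fin
open import Data.Fin.Properties using (all?; _≟_)
open import Data.List using (List; filter; length)
open import Data.List.Base using ()
open import Data.Vec.Functional using ()
open import Data.Product using (_×_; ∃)
open import Data.Sum using (_⊎_)
open import Relation.Nullary using (¬_; Dec)
open import Relation.Binary.PropositionalEquality using (_≡_; _≢_)
import Data.Integer.Properties as ℤP
open import Data.List using (allFin)

-- A quiver on vertex set Fin n, given by its exchange matrix q:
-- q i j = number of arrows i → j if positive, minus the number of arrows j → i
-- otherwise.  Skew-symmetry encodes "no loops, no 2-cycles".
record Quiver (n : ℕ) : Set where
  field
    q    : Fin n → Fin n → ℤ
    skew : ∀ i j → q j i ≡ - q i j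
open Quiver public

module _ {n : ℕ} (Q : Quiver n) where

  Arrow : Fin n → Fin n → Set
  Arrow a b = + 0 < q Q a b

  data PathIn (P : Fin n → Set) : Fin n → Fin n → Set where
    edge : ∀ {a b} → P a → P b → Arrow a b → PathIn P a b
    step : ∀ {a b c} → P a → Arrow a b → PathIn P b c → PathIn P a c

  AcyclicOn : (Fin n → Set) → Set
  AcyclicOn P = ∀ a → ¬ PathIn P a a

  AbundantOn : (Fin n → Set) → Set
  AbundantOn P = ∀ i j → P i → P j → i ≢ j → 2 ≤ ∣ q Q i j ∣

  IsKey : Fin n → Fin n → Set
  IsKey k k' =
    k ≢ k'
    × AbundantOn (λ x → x ≢ k) × AcyclicOn (λ x → x ≢ k)
    × AbundantOn (λ x → x ≢ k') × AcyclicOn (λ x → x ≢ k')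
    × (∀ i → i ≢ k → i ≢ k' →
         (Arrow k i × Arrow k' i) ⊎ (Arrow i k × Arrow i k'))

  -- an acyclic ordering: a total order on the vertices, given by an
  -- injective (hence bijective) position map, with a → b implying a ≺ b
  record AcyclicOrdering : Set where
    field
      pos       : Fin n → Fin n
      pos-inj   : ∀ a b → pos a ≡ pos b → a ≡ b
      respects  : ∀ a b → Arrow a b → Data.Fin._<_ (pos a) (pos b)

  _≺[_]_ : Fin n → AcyclicOrdering → Fin n → Set
  a ≺[ σ ] b = Data.Fin._<_ (AcyclicOrdering.pos σ a) (AcyclicOrdering.pos σ b)

  IsSource : Fin n → Set
  IsSource i = ∀ j → ¬ Arrow j i

  IsSink : Fin n → Set
  IsSink i = ∀ j → ¬ Arrow i j

  isSource? : ∀ i → Dec (IsSource i)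
  isSource? i = all? (λ j → Relation.Nullary.¬? (+ 0 ℤP.<? q Q j i))

  isSink? : ∀ i → Dec (IsSink i)
  isSink? i = all? (λ j → Relation.Nullary.¬? (+ 0 ℤP.<? q Q i j))

  numSources : ℕ
  numSources = length (filter isSource? (allFin n))

  numSinks : ℕ
  numSinks = length (filter isSink? (allFin n))

-- Q ∖ {k} is an abundant acyclic quiver, hence a transitive tournament, so it has a
-- source s.  If s = k', every other vertex lies below both k and k', which are then
-- the sources of Q (when k, k' are not joined); otherwise s points to k and k' and is
-- the unique source of Q.  When k → k' the same argument in Q ∖ {k'} yields a unique
-- source.  Sinks are the sources of the opposite quiver, which is again a key, and with
-- a third vertex r the two "dominating" cases cannot occur together (k → r → k).
module Submission where

open import Defs
open import Data.Nat using (ℕ; _≤_; zero; suc; s≤s; z≤n)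
import Data.Nat.Properties as ℕP
open import Data.Integer using (ℤ; +_; -_; -[1+_]; +[1+_]; +<+; ∣_∣)
import Data.Integer as ℤ
import Data.Integer.Properties as ℤP
open import Data.Fin using (Fin; punchIn; punchOut)
open import Data.Fin.Properties using (_≟_; <-asym; punchInᵢ≢i; punchIn-injective; punchIn-punchOut)
open import Data.List using (List; []; _∷_; filter; length; allFin)
open import Data.List.Membership.Propositional using (_∈_)
open import Data.List.Membership.Propositional.Properties using (∈-filter⁺; ∈-filter⁻; ∈-allFin)
open import Data.List.Membership.Propositional.Properties.WithK using (unique∧set⇒bag)
open import Data.List.Relation.Unary.All as All using (All; []; _∷_)
open import Data.List.Relation.Unary.Any using (here; there)
open import Data.List.Relation.Unary.Any.Properties using (singleton⁺; singleton⁻)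
open import Data.List.Relation.Unary.AllPairs using ([]; _∷_)
open import Data.List.Relation.Unary.Unique.Propositional using (Unique)
open import Data.List.Relation.Unary.Unique.Propositional.Properties using (filter⁺; allFin⁺)
open import Data.List.Relation.Binary.BagAndSetEquality using (∼bag⇒↭)
open import Data.List.Relation.Binary.Permutation.Propositional.Properties using (↭-length)
open import Data.Product as Product using (_×_; _,_; proj₁; proj₂; ∃)
open import Data.Sum as Sum using (_⊎_; inj₁; inj₂)
open import Data.Empty using (⊥-elim)
open import Function using (_∘_)
open import Function.Bundles using (_⇔_; mk⇔; Equivalence)
import Function.Properties.Equivalence as ⇔
open import Level using (0ℓ)
open import Relation.Nullary using (¬_; ¬?; Dec; yes; no; contradiction)
open import Relation.Unary using (Pred; Decidable)
open import Relation.Binary.PropositionalEquality using (_≡_; _≢_; refl; sym; trans; cong; subst)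

positive⇒¬negative : ∀ {z : ℤ} → + 0 ℤ.< z → ¬ (+ 0 ℤ.< - z)
positive⇒¬negative {+ zero} (+<+ ())
positive⇒¬negative {+[1+ m ]} _ ()

positive⊎negative : ∀ (z : ℤ) → 1 ≤ ∣ z ∣ → + 0 ℤ.< z ⊎ + 0 ℤ.< - z
positive⊎negative +[1+ m ] _ = inj₁ (+<+ (s≤s z≤n))
positive⊎negative -[1+ m ] _ = inj₂ (+<+ (s≤s z≤n))

length-filter-allFin : ∀ {n} {P : Pred (Fin n) 0ℓ} (P? : Decidable P) {ys : List (Fin n)} →
  Unique ys → (∀ x → P x ⇔ x ∈ ys) → length (filter P? (allFin n)) ≡ length ys
length-filter-allFin {n} P? unique-ys P⇔∈ys =
  ↭-length (∼bag⇒↭ (unique∧set⇒bag (filter⁺ P? {allFin n} (allFin⁺ n)) unique-ys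
    (λ {x} → mk⇔ (λ x∈ → Equivalence.to (P⇔∈ys x) (proj₂ (∈-filter⁻ P? {xs = allFin n} x∈)))
                 (λ x∈ → ∈-filter⁺ P? (∈-allFin x) (Equivalence.from (P⇔∈ys x) x∈)))))

third-vertex : ∀ {n} → 3 ≤ n → (k k' : Fin n) → k ≢ k' → ∃ λ r → r ≢ k × r ≢ k'
third-vertex {suc (suc (suc m))} (s≤s (s≤s (s≤s _))) k k' k≢k' =
  punchIn k t , punchInᵢ≢i k t , r≢k'
  where
    p t : Fin (suc (suc m))
    p = punchOut k≢k'
    t = punchIn p Fin.zero
    r≢k' : punchIn k t ≢ k'
    r≢k' r≡k' = punchInᵢ≢i p Fin.zero (punchIn-injective k t p (trans r≡k' (sym (punchIn-punchOut k≢k'))))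

-- numSinks Q and IsSink Q are definitionally numSources and IsSource of opposite Q.
opposite : ∀ {n} → Quiver n → Quiver n
opposite Q = record { q = λ a b → q Q b a ; skew = λ a b → skew Q b a }

module _ {n : ℕ} (Q : Quiver n) where

  arrow? : ∀ a b → Dec (Arrow Q a b)
  arrow? a b = + 0 ℤP.<? q Q a b

  arrow-asym : ∀ {a b} → Arrow Q a b → ¬ Arrow Q b a
  arrow-asym {a} {b} a→b b→a = positive⇒¬negative a→b (subst (+ 0 ℤ.<_) (skew Q a b) b→a)

  arrow-irrefl : ∀ {a} → ¬ Arrow Q a a
  arrow-irrefl a→a = arrow-asym a→a a→a

  arrow⊎arrow : ∀ {a b} → 1 ≤ ∣ q Q a b ∣ → Arrow Q a b ⊎ Arrow Q b a
  arrow⊎arrow {a} {b} 1≤∣q∣ =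
    Sum.map₂ (subst (+ 0 ℤ.<_) (sym (skew Q a b))) (positive⊎negative (q Q a b) 1≤∣q∣)

  q≡0⇒¬arrow : ∀ {a b} → q Q a b ≡ + 0 → ¬ Arrow Q a b
  q≡0⇒¬arrow q≡0 a→b = ℤP.<-irrefl refl (subst (+ 0 ℤ.<_) q≡0 a→b)

  q≡0⇒¬arrow˘ : ∀ {a b} → q Q a b ≡ + 0 → ¬ Arrow Q b a
  q≡0⇒¬arrow˘ {a} {b} q≡0 = q≡0⇒¬arrow (trans (skew Q a b) (cong -_ q≡0))

  ordering-agrees : (σ : AcyclicOrdering Q) → ∀ {k k' v} →
    (Arrow Q k v × Arrow Q k' v) ⊎ (Arrow Q v k × Arrow Q v k') →
    _≺[_]_ Q k σ v ⇔ _≺[_]_ Q k' σ v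
  ordering-agrees σ (inj₁ (k→v , k'→v)) = mk⇔ (λ _ → respects _ _ k'→v) (λ _ → respects _ _ k→v)
    where open AcyclicOrdering σ
  ordering-agrees σ (inj₂ (v→k , v→k')) =
    mk⇔ (λ k≺v → contradiction (respects _ _ v→k) (<-asym k≺v))
        (λ k'≺v → contradiction (respects _ _ v→k') (<-asym k'≺v))
    where open AcyclicOrdering σ

  Tournament : (Fin n → Set) → Set
  Tournament P = ∀ i j → P i → P j → i ≢ j → Arrow Q i j ⊎ Arrow Q j i

  TriangleFree : (Fin n → Set) → Set
  TriangleFree P = ∀ a b c → P a → P b → P c → Arrow Q a b → Arrow Q b c → ¬ Arrow Q c a

  abundant⇒tournament : ∀ {P} → AbundantOn Q P → Tournament P
  abundant⇒tournament abundant i j Pi Pj i≢j =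
    arrow⊎arrow (ℕP.≤-trans (ℕP.n≤1+n 1) (abundant i j Pi Pj i≢j))

  acyclic⇒triangleFree : ∀ {P} → AcyclicOn Q P → TriangleFree P
  acyclic⇒triangleFree acyclic a b c Pa Pb Pc a→b b→c c→a =
    acyclic a (step Pa a→b (step Pb b→c (edge Pc Pa c→a)))

  SourceIn : (Fin n → Set) → Fin n → Set
  SourceIn P s = P s × ∀ y → P y → ¬ Arrow Q y s

  module _ {P : Fin n → Set} (P? : Decidable P) (tournament : Tournament P) (triangleFree : TriangleFree P) where

    private
      Unentered : Fin n → Fin n → Set
      Unentered s y = P y → ¬ Arrow Q y s

      overtake : ∀ {x s y} → P x → P s → Arrow Q x s → Unentered s y → Unentered x y
      overtake {x} {s} {y} Px Ps x→s s-unentered Py y→x with y ≟ s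
      ... | yes refl = arrow-asym x→s y→x
      ... | no y≢s with tournament y s Py Ps y≢s
      ...   | inj₁ y→s = s-unentered Py y→s
      ...   | inj₂ s→y = triangleFree x s y Px Ps Py x→s s→y y→x

      candidate : ∀ {m} → P m → (xs : List (Fin n)) → ∃ λ s → P s × All (Unentered s) xs
      candidate {m} Pm [] = m , Pm , []
      candidate Pm (x ∷ xs) with candidate Pm xs
      ... | s , Ps , unentered with P? x | arrow? x s
      ...   | no ¬Px | _ = s , Ps , (λ Px → contradiction Px ¬Px) ∷ unentered
      ...   | yes _ | no ¬x→s = s , Ps , (λ _ → ¬x→s) ∷ unentered
      ...   | yes Px | yes x→s = x , Px , (λ _ → arrow-irrefl) ∷ All.map (overtake Px Ps x→s) unentered

    sourceIn-exists : ∀ {m} → P m → ∃ (SourceIn P)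
    sourceIn-exists Pm with candidate Pm (allFin n)
    ... | s , Ps , unentered = s , Ps , λ y → All.lookup unentered (∈-allFin y)

  UniqueSource : Set
  UniqueSource = ∃ λ s → ∀ x → IsSource Q x ⇔ x ≡ s

  sourceIn-complement⇒uniqueSource : ∀ {c s} → Tournament (_≢ c) → SourceIn (_≢ c) s →
    ¬ Arrow Q c s → ¬ IsSource Q c → UniqueSource
  sourceIn-complement⇒uniqueSource {c} {s} tournament (s≢c , s-source) ¬c→s ¬source-c =
    s , λ x → mk⇔ to from
    where
      from : ∀ {x} → x ≡ s → IsSource Q x
      from refl j j→s with j ≟ c
      ... | yes refl = ¬c→s j→s
      ... | no j≢c = s-source j j≢c j→s
      to : ∀ {x} → IsSource Q x → x ≡ s
      to {x} source-x with x ≟ c | x ≟ s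
      ... | yes refl | _ = contradiction source-x ¬source-c
      ... | no _ | yes x≡s = x≡s
      ... | no x≢c | no x≢s with tournament x s x≢c s≢c x≢s
      ...   | inj₁ x→s = ⊥-elim (s-source x x≢c x→s)
      ...   | inj₂ s→x = ⊥-elim (source-x s s→x)

  Dominate : Fin n → Fin n → Set
  Dominate k k' = ∀ i → i ≢ k → i ≢ k' → Arrow Q k i × Arrow Q k' i

  dominate-swap : ∀ {k k'} → Dominate k k' → Dominate k' k
  dominate-swap dominate i i≢k' i≢k = Product.swap (dominate i i≢k i≢k')

  dominating-isSource : ∀ {k k'} → ¬ Arrow Q k' k → Dominate k k' → IsSource Q k
  dominating-isSource {k} {k'} ¬k'→k dominate j j→k with j ≟ k | j ≟ k'
  ... | yes refl | _ = arrow-irrefl j→k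
  ... | no _ | yes refl = ¬k'→k j→k
  ... | no j≢k | no j≢k' = arrow-asym (proj₁ (dominate j j≢k j≢k')) j→k

  dominating-sources : ∀ {k k'} → ¬ Arrow Q k k' → ¬ Arrow Q k' k → Dominate k k' →
    ∀ x → IsSource Q x ⇔ (x ≡ k ⊎ x ≡ k')
  dominating-sources {k} {k'} ¬k→k' ¬k'→k dominate x = mk⇔ to from
    where
      to : IsSource Q x → x ≡ k ⊎ x ≡ k'
      to source-x with x ≟ k | x ≟ k'
      ... | yes x≡k | _ = inj₁ x≡k
      ... | no _ | yes x≡k' = inj₂ x≡k'
      ... | no x≢k | no x≢k' = ⊥-elim (source-x k (proj₁ (dominate x x≢k x≢k')))
      from : ∀ {x} → x ≡ k ⊎ x ≡ k' → IsSource Q x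
      from (inj₁ refl) = dominating-isSource ¬k'→k dominate
      from (inj₂ refl) = dominating-isSource ¬k→k' (dominate-swap dominate)

  numSources-unique : UniqueSource → numSources Q ≡ 1
  numSources-unique (s , source⇔≡s) =
    length-filter-allFin (isSource? Q) ([] ∷ []) (λ x → ⇔.trans (source⇔≡s x) (mk⇔ singleton⁺ singleton⁻))

  numSources-dominating : ∀ {k k'} → k ≢ k' → ¬ Arrow Q k k' → ¬ Arrow Q k' k → Dominate k k' →
    numSources Q ≡ 2
  numSources-dominating k≢k' ¬k→k' ¬k'→k dominate =
    length-filter-allFin (isSource? Q) ((k≢k' ∷ []) ∷ [] ∷ [])
      (λ x → ⇔.trans (dominating-sources ¬k→k' ¬k'→k dominate x) (mk⇔ ≡⇒∈ ∈⇒≡))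
    where
      ≡⇒∈ : ∀ {x k k'} → x ≡ k ⊎ x ≡ k' → x ∈ k ∷ k' ∷ []
      ≡⇒∈ (inj₁ x≡k) = here x≡k
      ≡⇒∈ (inj₂ x≡k') = there (here x≡k')
      ∈⇒≡ : ∀ {x k k'} → x ∈ k ∷ k' ∷ [] → x ≡ k ⊎ x ≡ k'
      ∈⇒≡ (here x≡k) = inj₁ x≡k
      ∈⇒≡ (there (here x≡k')) = inj₂ x≡k'

  record TransitiveKey (k k' : Fin n) : Set where
    field
      distinct      : k ≢ k'
      tournament    : Tournament (_≢ k)
      triangleFree  : TriangleFree (_≢ k)
      tournament'   : Tournament (_≢ k')
      triangleFree' : TriangleFree (_≢ k')
      uniform       : ∀ i → i ≢ k → i ≢ k' →
                      (Arrow Q k i × Arrow Q k' i) ⊎ (Arrow Q i k × Arrow Q i k')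

  isKey⇒transitiveKey : ∀ {k k'} → IsKey Q k k' → TransitiveKey k k'
  isKey⇒transitiveKey (k≢k' , abundant , acyclic , abundant' , acyclic' , uniform) = record
    { distinct      = k≢k'
    ; tournament    = abundant⇒tournament abundant
    ; triangleFree  = acyclic⇒triangleFree acyclic
    ; tournament'   = abundant⇒tournament abundant'
    ; triangleFree' = acyclic⇒triangleFree acyclic'
    ; uniform       = uniform
    }

  swap-key : ∀ {k k'} → TransitiveKey k k' → TransitiveKey k' k
  swap-key key = record
    { distinct      = distinct ∘ sym
    ; tournament    = tournament'
    ; triangleFree  = triangleFree'
    ; tournament'   = tournament
    ; triangleFree' = triangleFree
    ; uniform       = λ i i≢k' i≢k → Sum.map Product.swap Product.swap (uniform i i≢k i≢k')
    }
    where open TransitiveKey key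

  module _ {k k'} (key : TransitiveKey k k') where
    open TransitiveKey key

    complement-source : ∃ (SourceIn (_≢ k))
    complement-source = sourceIn-exists (λ x → ¬? (x ≟ k)) tournament triangleFree (distinct ∘ sym)

    complement-source-above-key : ∀ {s} → SourceIn (_≢ k) s → s ≢ k' → Arrow Q s k × Arrow Q s k'
    complement-source-above-key (s≢k , s-source) s≢k' with uniform _ s≢k s≢k'
    ... | inj₁ (_ , k'→s) = ⊥-elim (s-source _ (distinct ∘ sym) k'→s)
    ... | inj₂ s→k,k' = s→k,k'

    k'-source⇒dominate : SourceIn (_≢ k) k' → Dominate k k'
    k'-source⇒dominate (_ , k'-source) i i≢k i≢k' with uniform i i≢k i≢k'
    ... | inj₁ k,k'→i = k,k'→i
    ... | inj₂ (_ , i→k') = ⊥-elim (k'-source i i≢k i→k')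

    dominate⊎uniqueSource : Dominate k k' ⊎ UniqueSource
    dominate⊎uniqueSource with complement-source
    ... | s , s-source with s ≟ k'
    ...   | yes refl = inj₁ (k'-source⇒dominate s-source)
    ...   | no s≢k' = inj₂ (sourceIn-complement⇒uniqueSource tournament s-source
                              (arrow-asym s→k) (λ source-k → source-k s s→k))
      where
        s→k : Arrow Q s k
        s→k = proj₁ (complement-source-above-key s-source s≢k')

  linked-key-source : ∀ {k k'} → TransitiveKey k k' → Arrow Q k k' → UniqueSource
  linked-key-source {k} {k'} key k→k' with complement-source (swap-key key)
  ... | s , s-source = sourceIn-complement⇒uniqueSource (TransitiveKey.tournament' key) s-source
                         ¬k'→s (λ source-k' → source-k' k k→k')
    where
      ¬k'→s : ¬ Arrow Q k' s
      ¬k'→s with s ≟ k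
      ... | yes s≡k = arrow-asym k→k' ∘ subst (Arrow Q k') s≡k
      ... | no s≢k = arrow-asym (proj₁ (complement-source-above-key (swap-key key) s-source s≢k))

opposite-key : ∀ {n} {Q : Quiver n} {k k'} → TransitiveKey Q k k' → TransitiveKey (opposite Q) k k'
opposite-key key = record
  { distinct      = distinct
  ; tournament    = λ i j Pi Pj i≢j → Sum.swap (tournament i j Pi Pj i≢j)
  ; triangleFree  = λ a b c Pa Pb Pc b→a c→b → triangleFree c b a Pc Pb Pa c→b b→a
  ; tournament'   = λ i j Pi Pj i≢j → Sum.swap (tournament' i j Pi Pj i≢j)
  ; triangleFree' = λ a b c Pa Pb Pc b→a c→b → triangleFree' c b a Pc Pb Pa c→b b→a
  ; uniform       = λ i i≢k i≢k' → Sum.swap (uniform i i≢k i≢k')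
  }
  where open TransitiveKey key

≡1⇒≢2 : ∀ {m : ℕ} → m ≡ 1 → m ≢ 2
≡1⇒≢2 refl ()

unlinked-key-counts : ∀ {n} {Q : Quiver n} {k k'} → TransitiveKey Q k k' →
  ¬ Arrow Q k k' → ¬ Arrow Q k' k → ∃ (λ r → r ≢ k × r ≢ k') →
  ((numSources Q ≡ 1 × numSinks Q ≡ 1)
   ⊎ (numSources Q ≡ 2 × numSinks Q ≡ 1)
   ⊎ (numSources Q ≡ 1 × numSinks Q ≡ 2))
  × (numSources Q ≡ 2 → IsSource Q k × IsSource Q k')
  × (numSinks Q ≡ 2 → IsSink Q k × IsSink Q k')
unlinked-key-counts {Q = Q} key ¬k→k' ¬k'→k (r , r≢k , r≢k')
  with dominate⊎uniqueSource Q key | dominate⊎uniqueSource (opposite Q) (opposite-key key)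
... | inj₁ dominate | inj₁ dominated =
  ⊥-elim (arrow-asym Q (proj₁ (dominate r r≢k r≢k')) (proj₁ (dominated r r≢k r≢k')))
... | inj₁ dominate | inj₂ sink =
  inj₂ (inj₁ (numSources-dominating Q (TransitiveKey.distinct key) ¬k→k' ¬k'→k dominate , one-sink))
  , (λ _ → dominating-isSource Q ¬k'→k dominate
         , dominating-isSource Q ¬k→k' (dominate-swap Q dominate))
  , ⊥-elim ∘ ≡1⇒≢2 one-sink
  where
    one-sink : numSinks Q ≡ 1
    one-sink = numSources-unique (opposite Q) sink
... | inj₂ source | inj₁ dominated =
  inj₂ (inj₂ (one-source , numSources-dominating (opposite Q) (TransitiveKey.distinct key) ¬k'→k ¬k→k' dominated))
  , ⊥-elim ∘ ≡1⇒≢2 one-source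
  , (λ _ → dominating-isSource (opposite Q) ¬k→k' dominated
         , dominating-isSource (opposite Q) ¬k'→k (dominate-swap (opposite Q) dominated))
  where
    one-source : numSources Q ≡ 1
    one-source = numSources-unique Q source
... | inj₂ source | inj₂ sink =
  inj₁ (one-source , one-sink) , ⊥-elim ∘ ≡1⇒≢2 one-source , ⊥-elim ∘ ≡1⇒≢2 one-sink
  where
    one-source : numSources Q ≡ 1
    one-source = numSources-unique Q source
    one-sink : numSinks Q ≡ 1
    one-sink = numSources-unique (opposite Q) sink

linked-key-counts : ∀ {n} {Q : Quiver n} {k k'} → TransitiveKey Q k k' → Arrow Q k k' →
  numSources Q ≡ 1 × numSinks Q ≡ 1
linked-key-counts {Q = Q} key k→k' =
  numSources-unique Q (linked-key-source Q key k→k')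
  , numSources-unique (opposite Q) (linked-key-source (opposite Q) (opposite-key (swap-key Q key)) k→k')

single-arrow-key-counts : ∀ {n} {Q : Quiver n} {k k'} → TransitiveKey Q k k' → ∣ q Q k k' ∣ ≡ 1 →
  numSources Q ≡ 1 × numSinks Q ≡ 1
single-arrow-key-counts {Q = Q} key ∣q∣≡1 with arrow⊎arrow Q (ℕP.≤-reflexive (sym ∣q∣≡1))
... | inj₁ k→k' = linked-key-counts key k→k'
... | inj₂ k'→k = linked-key-counts (swap-key Q key) k'→k

corollary4p4 : ∀ {n : ℕ} (Q : Quiver n) (k k' : Fin n) → IsKey Q k k' →
    ((σ : AcyclicOrdering Q) (v : Fin n) → v ≢ k → v ≢ k' →
      (_≺[_]_ Q k σ v ⇔ _≺[_]_ Q k' σ v))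
    × (3 ≤ n → q Q k k' ≡ + 0 →
      ((numSources Q ≡ 1 × numSinks Q ≡ 1)
       ⊎ (numSources Q ≡ 2 × numSinks Q ≡ 1)
       ⊎ (numSources Q ≡ 1 × numSinks Q ≡ 2))
      × (numSources Q ≡ 2 → IsSource Q k × IsSource Q k')
      × (numSinks Q ≡ 2 → IsSink Q k × IsSink Q k'))
    × (∣ q Q k k' ∣ ≡ 1 → numSources Q ≡ 1 × numSinks Q ≡ 1)
corollary4p4 Q k k' isKey =
    (λ σ v v≢k v≢k' → ordering-agrees Q σ (uniform v v≢k v≢k'))
  , (λ 3≤n q≡0 → unlinked-key-counts key (q≡0⇒¬arrow Q q≡0) (q≡0⇒¬arrow˘ Q q≡0)
                   (third-vertex 3≤n k k' distinct))
  , single-arrow-key-counts key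
  where
    key : TransitiveKey Q k k'
    key = isKey⇒transitiveKey Q isKey
    open TransitiveKey key
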